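{- For integers $m\ge 2$ and $n\ge 3m+2$, $R_{\pi}(K_{1,n},B_m)=n$.
   Context: All graphs are finite and simple. For graphs $F,G,H$, write $F\rightarrow(G,H)$ if every red-blue coloring of the edges of $F$ contains a red copy of $G$ or a blue copy of $H$. The Ramsey number $R(G,H)$ is the smallest $r$ with $K_r\rightarrow(G,H)$. $K_r\setminus P_k$ denotes $K_r$ with the edges of a path on $k$ vertices ($k\le r$) deleted. The path-critical Ramsey number is $R_{\pi}(G,H)=\max\{k: K_r\setminus P_k\rightarrow(G,H)\}$ where $r=R(G,H)$. $K_{1,n}$ is the star with $n$ leaves, and $B_m=K_2+mK_1$ is the book graph: $m$ vertices each joined to both ends of an edge (here $G+H$ denotes the join of disjoint $G$ and $H$, and $mK_1$ is $m$ isolated vertices). -}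

module Defs where

open import Data.Nat using (ℕ; zero; suc; _<_; _≤_; _<ᵇ_; _≡ᵇ_)
open import Data.Fin using (Fin; zero; suc; toℕ; _≟_)
open import Data.Bool using (Bool; true; false; _∧_; _∨_; not)
open import Data.Product using (Σ; _×_)
open import Data.Sum using (_⊎_)
open import Relation.Nullary using (¬_; does)
open import Relation.Binary.PropositionalEquality using (_≡_)
open import Function.Definitions using (Injective)

record Graph : Set where
  field
    size   : ℕ
    adj    : Fin size → Fin size → Bool
    sym    : ∀ u v → adj u v ≡ adj v u
    irrefl : ∀ u → adj u u ≡ false
open Graph public

data Colour : Set where
  red blue : Colour

record Colouring (F : Graph) : Set where
  field
    col : Fin (size F) → Fin (size F) → Colour
    col-sym : ∀ u v → col u v ≡ col v u
open Colouring public

MonoCopy : (F : Graph) → Colouring F → Colour → (G : Graph) → Set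
MonoCopy F c κ G =
  Σ (Fin (size G) → Fin (size F)) λ f →
    Injective _≡_ _≡_ f ×
    (∀ u v → adj G u v ≡ true →
       (adj F (f u) (f v) ≡ true) × (col c (f u) (f v) ≡ κ))

Arrows : Graph → Graph → Graph → Set
Arrows F G H = (c : Colouring F) → MonoCopy F c red G ⊎ MonoCopy F c blue H

distinct : ∀ {r} → Fin r → Fin r → Bool
distinct i j = not (does (i ≟ j))

pathEdge : ∀ {r} → ℕ → Fin r → Fin r → Bool
pathEdge k i j =
  ((toℕ i <ᵇ k) ∧ (toℕ j <ᵇ k)) ∧
  ((suc (toℕ i) ≡ᵇ toℕ j) ∨ (suc (toℕ j) ≡ᵇ toℕ i))

-- K_r \ P_k  (for k ≤ r): K_r with the edges of the path on vertices 0,...,k-1 removed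
KminusP : ℕ → ℕ → Graph
KminusP r k = record
  { size = r
  ; adj = λ i j → distinct i j ∧ not (pathEdge k i j)
  ; sym = symP
  ; irrefl = irr
  }
  where
  open import Data.Bool.Properties using (∨-comm)
  open import Relation.Binary.PropositionalEquality using (refl; cong₂; cong)
  open import Data.Bool.Properties using (∧-comm)
  distinct-sym : (i j : Fin r) → distinct i j ≡ distinct j i
  distinct-sym i j with i ≟ j | j ≟ i
  ... | Relation.Nullary.yes _ | Relation.Nullary.yes _ = refl
  ... | Relation.Nullary.no _ | Relation.Nullary.no _ = refl
  ... | Relation.Nullary.yes refl | Relation.Nullary.no ¬p = Data.Empty.⊥-elim (¬p refl)
    where import Data.Empty
  ... | Relation.Nullary.no ¬p | Relation.Nullary.yes refl = Data.Empty.⊥-elim (¬p refl)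
    where import Data.Empty
  symP : (i j : Fin r) → (distinct i j ∧ not (pathEdge k i j)) ≡ (distinct j i ∧ not (pathEdge k j i))
  symP i j = cong₂ _∧_ (distinct-sym i j)
    (cong not (cong₂ _∧_ (∧-comm (toℕ i <ᵇ k) (toℕ j <ᵇ k))
                         (∨-comm (suc (toℕ i) ≡ᵇ toℕ j) (suc (toℕ j) ≡ᵇ toℕ i))))
  irr : (i : Fin r) → (distinct i i ∧ not (pathEdge k i i)) ≡ false
  irr i with i ≟ i
  ... | Relation.Nullary.yes _ = refl
  ... | Relation.Nullary.no ¬p = Data.Empty.⊥-elim (¬p refl)
    where import Data.Empty

K : ℕ → Graph
K r = KminusP r 0

starAdj : ∀ {n} → Fin (suc n) → Fin (suc n) → Bool
starAdj zero zero = false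
starAdj zero (suc _) = true
starAdj (suc _) zero = true
starAdj (suc _) (suc _) = false

Star : ℕ → Graph
Star n = record { size = suc n ; adj = starAdj ; sym = s ; irrefl = ir }
  where
  open import Relation.Binary.PropositionalEquality using (refl)
  s : (u v : Fin (suc n)) → starAdj u v ≡ starAdj v u
  s zero zero = refl
  s zero (suc _) = refl
  s (suc _) zero = refl
  s (suc _) (suc _) = refl
  ir : (u : Fin (suc n)) → starAdj u u ≡ false
  ir zero = refl
  ir (suc _) = refl

-- book B_m = K_2 + m K_1: spine vertices 0,1; page vertices 2..m+1
bookAdj : ∀ {m} → Fin (suc (suc m)) → Fin (suc (suc m)) → Bool
bookAdj zero zero = false
bookAdj zero (suc _) = true
bookAdj (suc zero) zero = true
bookAdj (suc zero) (suc zero) = false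
bookAdj (suc zero) (suc (suc _)) = true
bookAdj (suc (suc _)) zero = true
bookAdj (suc (suc _)) (suc zero) = true
bookAdj (suc (suc _)) (suc (suc _)) = false

Book : ℕ → Graph
Book m = record { size = suc (suc m) ; adj = bookAdj ; sym = s ; irrefl = ir }
  where
  open import Relation.Binary.PropositionalEquality using (refl)
  s : (u v : Fin (suc (suc m))) → bookAdj u v ≡ bookAdj v u
  s zero zero = refl
  s zero (suc zero) = refl
  s zero (suc (suc _)) = refl
  s (suc zero) zero = refl
  s (suc zero) (suc zero) = refl
  s (suc zero) (suc (suc _)) = refl
  s (suc (suc _)) zero = refl
  s (suc (suc _)) (suc zero) = refl
  s (suc (suc _)) (suc (suc _)) = refl
  ir : (u : Fin (suc (suc m))) → bookAdj u u ≡ false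
  ir zero = refl
  ir (suc zero) = refl
  ir (suc (suc _)) = refl

IsRamseyNumber : Graph → Graph → ℕ → Set
IsRamseyNumber G H r = Arrows (K r) G H × (∀ s → s < r → ¬ Arrows (K s) G H)

IsPathCriticalRamseyNumber : Graph → Graph → ℕ → Set
IsPathCriticalRamseyNumber G H k =
  Σ ℕ λ r → IsRamseyNumber G H r × k ≤ r × Arrows (KminusP r k) G H ×
    (∀ j → k < j → j ≤ r → ¬ Arrows (KminusP r j) G H)

{-# OPTIONS --safe #-}
-- Lower bounds: colour red inside two sides and blue across them. The blue graph is then
-- bipartite, so it has no triangle and hence no B_m, and every vertex has fewer than n red
-- neighbours: for K_s with s ≤ 2n take two sides of size at most n; for K_{2n+1} \ P_j with
-- j > n take the sides {0,…,n} and {n+1,…,2n}, where the path removes a red edge at every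
-- vertex of the larger side.
--
-- Upper bound: in a colouring of K_{2n+1} \ P_n, suppose that every red degree is below n
-- and that the ends of every blue edge have fewer than m common blue neighbours. The vertex
-- u = 2n is off the path, so its blue degree is at least n+1. Only n vertices lie on the
-- path, so u has a blue neighbour v off the path, and v also has blue degree at least n+1.
-- Since v is adjacent to every other vertex, N_B(u) ⊆ (N_B(u) ∩ N_B(v)) ∪ N_R(v) ∪ {v}, which
-- gives a common blue neighbour v′. Its blue degree is at least n−1, because it has at most
-- three non-neighbours (itself and its path neighbours). The Bonferroni inequality for
-- N_B(u), N_B(v) and N_B(v′) then gives 3n+1 ≤ (2n+1) + 3(m−1), contradicting 3m ≤ n+2. As
-- K_{2n+1} contains K_{2n+1} \ P_n, this also shows that R(K_{1,n}, B_m) = 2n+1.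

module Submission where

open import Defs hiding (sym)
open import Data.Nat using (ℕ; zero; suc; pred; _≤_; _<_; _+_; _*_; _⊓_; _<ᵇ_; _≡ᵇ_; z≤n; s≤s; s≤s⁻¹; z<s; _≤?_; _<?_)
import Data.Nat as ℕ
open import Data.Nat.Properties hiding (_≟_)
open import Data.Nat.Tactic.RingSolver using (solve-∀)
open import Data.Fin using (Fin; zero; suc; toℕ; fromℕ; fromℕ<; inject₁; _≟_)
open import Data.Fin.Properties using (any?; toℕ-fromℕ; toℕ-fromℕ<; toℕ-inject₁)
import Data.Fin.Properties as Fin
open import Data.Bool using (Bool; true; false; _∧_; _∨_; not; if_then_else_; T)
import Data.Bool as Bool
open import Data.Bool.Properties using (∧-conicalˡ; ∧-conicalʳ; ∧-distribʳ-∨; ∧-identityʳ; ∧-zeroʳ; ∨-zeroʳ; not-injective)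
open import Data.Product using (Σ; ∃; _×_; _,_; proj₁; proj₂)
open import Data.Sum using (_⊎_; inj₁; inj₂; [_,_]′)
import Data.Sum as Sum
open import Data.Empty using (⊥; ⊥-elim)
import Data.Vec.Functional as Vector
open import Function using (_∘_; id)
open import Function.Definitions using (Injective)
open import Relation.Nullary using (¬_; yes; no; contradiction)
open import Relation.Nullary.Decidable using (dec-true; dec-false; _×-dec_)
open import Relation.Binary.PropositionalEquality using (_≡_; _≢_; refl; sym; trans; cong; cong₂; subst)

private variable
  r k : ℕ

≡ᵇ-true⇒≡ : ∀ {m n} → (m ≡ᵇ n) ≡ true → m ≡ n
≡ᵇ-true⇒≡ {m} {n} e = ≡ᵇ⇒≡ m n (subst T (sym e) _)

<ᵇ-true⇒< : ∀ {m n} → (m <ᵇ n) ≡ true → m < n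
<ᵇ-true⇒< {m} {n} e = <ᵇ⇒< m n (subst T (sym e) _)

<ᵇ-false⇒≥ : ∀ {m n} → (m <ᵇ n) ≡ false → n ≤ m
<ᵇ-false⇒≥ e = ≮⇒≥ (λ m<n → subst T e (<⇒<ᵇ m<n))

≡⇒≡ᵇ-true : ∀ {m n} → m ≡ n → (m ≡ᵇ n) ≡ true
≡⇒≡ᵇ-true {m} {n} = dec-true (m ℕ.≟ n)

<⇒<ᵇ-true : ∀ {m n} → m < n → (m <ᵇ n) ≡ true
<⇒<ᵇ-true {m} {n} = dec-true (m <? n)

≥⇒<ᵇ-false : ∀ {m n} → n ≤ m → (m <ᵇ n) ≡ false
≥⇒<ᵇ-false {m} {n} = dec-false (m <? n) ∘ ≤⇒≯

∨-introˡ : ∀ {a} b → a ≡ true → a ∨ b ≡ true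
∨-introˡ b refl = refl

∨-introʳ : ∀ a {b} → b ≡ true → a ∨ b ≡ true
∨-introʳ a refl = ∨-zeroʳ a

distinct-≢ : {i j : Fin r} → i ≢ j → distinct i j ≡ true
distinct-≢ {i = i} {j} i≢j = cong not (dec-false (i ≟ j) i≢j)

distinct⇒≢ : {i j : Fin r} → distinct i j ≡ true → i ≢ j
distinct⇒≢ {i = i} e refl = contradiction (trans (sym e) (cong not (dec-true (i ≟ i) refl))) λ ()

∧-intro : ∀ {a b} → a ≡ true → b ≡ true → a ∧ b ≡ true
∧-intro refl refl = refl

∷-injective : ∀ {A : Set} {x : A} {g : Fin k → A} → Injective _≡_ _≡_ g → (∀ i → g i ≢ x) →
  Injective _≡_ _≡_ (x Vector.∷ g)
∷-injective g-inj g≢x {zero}  {zero}  _ = refl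
∷-injective g-inj g≢x {zero}  {suc j} e = contradiction (sym e) (g≢x j)
∷-injective g-inj g≢x {suc i} {zero}  e = contradiction e (g≢x i)
∷-injective g-inj g≢x {suc i} {suc j} e = cong suc (g-inj e)

-- Counting subsets of Fin r

count : (Fin r → Bool) → ℕ
count {zero}  p = 0
count {suc r} p = if p zero then suc (count (p ∘ suc)) else count (p ∘ suc)

_⊆_ : (Fin r → Bool) → (Fin r → Bool) → Set
p ⊆ q = ∀ i → p i ≡ true → q i ≡ true

_∩_ _∪_ : (Fin r → Bool) → (Fin r → Bool) → Fin r → Bool
(p ∩ q) i = p i ∧ q i
(p ∪ q) i = p i ∨ q i

∁ : (Fin r → Bool) → Fin r → Bool
∁ p i = not (p i)

_-_ : (Fin r → Bool) → Fin r → Fin r → Bool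
(p - x) i = distinct i x ∧ p i

count-mono : (p q : Fin r → Bool) → p ⊆ q → count p ≤ count q
count-mono {zero}  p q p⊆q = z≤n
count-mono {suc r} p q p⊆q with p zero in p₀ | q zero in q₀
... | true  | true  = s≤s (count-mono _ _ (p⊆q ∘ suc))
... | true  | false = contradiction (trans (sym (p⊆q zero p₀)) q₀) λ ()
... | false | true  = m≤n⇒m≤1+n (count-mono _ _ (p⊆q ∘ suc))
... | false | false = count-mono _ _ (p⊆q ∘ suc)

count+count-∁ : (p : Fin r → Bool) → count p + count (∁ p) ≡ r
count+count-∁ {zero}  p = refl
count+count-∁ {suc r} p with p zero
... | true  = cong suc (count+count-∁ (p ∘ suc))
... | false = trans (+-suc _ _) (cong suc (count+count-∁ (p ∘ suc)))

count≤size : (p : Fin r → Bool) → count p ≤ r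
count≤size {r} p = subst (count p ≤_) (count+count-∁ p) (m≤m+n _ _)

count-∩-∩∁ : (p q : Fin r → Bool) → count p ≡ count (p ∩ q) + count (p ∩ ∁ q)
count-∩-∩∁ {zero}  p q = refl
count-∩-∩∁ {suc r} p q with p zero | q zero
... | true  | true  = cong suc (count-∩-∩∁ (p ∘ suc) (q ∘ suc))
... | true  | false = trans (cong suc (count-∩-∩∁ (p ∘ suc) (q ∘ suc))) (sym (+-suc _ _))
... | false | _     = count-∩-∩∁ (p ∘ suc) (q ∘ suc)

count-∪-∩ : (p q : Fin r → Bool) → count p + count q ≡ count (p ∪ q) + count (p ∩ q)
count-∪-∩ {zero}  p q = refl
count-∪-∩ {suc r} p q with p zero | q zero
... | true  | true  = cong suc (trans (+-suc _ _) (trans (cong suc (count-∪-∩ (p ∘ suc) (q ∘ suc))) (sym (+-suc _ _))))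
... | true  | false = cong suc (count-∪-∩ (p ∘ suc) (q ∘ suc))
... | false | true  = trans (+-suc _ _) (cong suc (count-∪-∩ (p ∘ suc) (q ∘ suc)))
... | false | false = count-∪-∩ (p ∘ suc) (q ∘ suc)

count-∪ : (p q : Fin r → Bool) → count (p ∪ q) ≤ count p + count q
count-∪ p q = subst (count (p ∪ q) ≤_) (sym (count-∪-∩ p q)) (m≤m+n _ _)

count-remove : (p : Fin r → Bool) (x : Fin r) → p x ≡ true → count p ≡ suc (count (p - x))
count-remove {suc r} p zero    px rewrite px = refl
count-remove {suc r} p (suc x) px with p zero
... | true  = cong suc (count-remove (p ∘ suc) x px)
... | false = count-remove (p ∘ suc) x px

count-< : (p q : Fin r → Bool) (y : Fin r) → p ⊆ q → q y ≡ true → p y ≡ false → count p < count q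
count-< p q y p⊆q qy py = begin-strict
  count p        ≤⟨ count-mono p (q - y) p⊆q-y ⟩
  count (q - y)  <⟨ n<1+n _ ⟩
  suc (count (q - y)) ≡⟨ sym (count-remove q y qy) ⟩
  count q        ∎
  where
  open ≤-Reasoning
  p⊆q-y : p ⊆ (q - y)
  p⊆q-y i pi with i ≟ y
  ... | yes refl = contradiction (trans (sym pi) py) λ ()
  ... | no  i≢y  = p⊆q i pi

count-≡0 : (p : Fin r → Bool) → (∀ i → p i ≢ true) → count p ≡ 0
count-≡0 {zero}  p _  = refl
count-≡0 {suc r} p ¬p with p zero in p₀
... | true  = contradiction p₀ (¬p zero)
... | false = count-≡0 (p ∘ suc) (¬p ∘ suc)

count-≤1 : (p : Fin r → Bool) → (∀ i → p i ≡ true → toℕ i ≡ k) → count p ≤ 1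
count-≤1 {zero}  p _ = z≤n
count-≤1 {suc r} {k} p p⇒k with p zero in p₀
... | true  = s≤s (≤-reflexive (count-≡0 (p ∘ suc) λ i pi → 1+n≢0 (trans (p⇒k (suc i) pi) (sym (p⇒k zero p₀)))))
... | false = count-≤1 (p ∘ suc) (λ i pi → cong pred (p⇒k (suc i) pi))

count-toℕ<ᵇ : ∀ r t → count {r} (λ i → toℕ i <ᵇ t) ≡ r ⊓ t
count-toℕ<ᵇ zero    t       = refl
count-toℕ<ᵇ (suc r) zero    = count-≡0 {r} (λ _ → false) λ _ ()
count-toℕ<ᵇ (suc r) (suc t) = cong suc (count-toℕ<ᵇ r t)

0<count⇒∃ : (p : Fin r → Bool) → 0 < count p → ∃ λ i → p i ≡ true
0<count⇒∃ {suc r} p h with p zero in p₀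
... | true  = zero , p₀
... | false with (i , pi) ← 0<count⇒∃ (p ∘ suc) h = suc i , pi

≤count⇒injection : ∀ k (p : Fin r → Bool) → k ≤ count p →
  Σ (Fin k → Fin r) λ g → Injective _≡_ _≡_ g × (∀ i → p (g i) ≡ true)
≤count⇒injection zero    p _ = (λ ()) , (λ { {()} }) , (λ ())
≤count⇒injection (suc k) p k<count
  with x , px ← 0<count⇒∃ p (≤-trans (s≤s z≤n) k<count)
  with g , g-inj , g∈ ← ≤count⇒injection k (p - x) (s≤s⁻¹ (subst (suc k ≤_) (count-remove p x px) k<count))
  = x Vector.∷ g , ∷-injective g-inj (λ i → distinct⇒≢ (∧-conicalˡ _ _ (g∈ i))) , ∈
  where
  ∈ : ∀ i → p ((x Vector.∷ g) i) ≡ true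
  ∈ zero    = px
  ∈ (suc i) = ∧-conicalʳ _ _ (g∈ i)

injection⇒≤count : ∀ k (p : Fin r → Bool) (g : Fin k → Fin r) → Injective _≡_ _≡_ g →
  (∀ i → p (g i) ≡ true) → k ≤ count p
injection⇒≤count zero    p g _     _  = z≤n
injection⇒≤count (suc k) p g g-inj g∈ = subst (suc k ≤_) (sym (count-remove p (g zero) (g∈ zero)))
  (s≤s (injection⇒≤count k (p - g zero) (g ∘ suc) (Fin.suc-injective ∘ g-inj) λ i →
    ∧-intro (distinct-≢ (λ e → Fin.0≢1+n (sym (g-inj e)))) (g∈ (suc i))))

count-bonferroni : (p q s : Fin r → Bool) →
  count p + count q + count s ≤ r + (count (p ∩ q) + count (p ∩ s) + count (q ∩ s))
count-bonferroni {r} p q s = begin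
  count p + count q + count s                           ≡⟨ cong (_+ count s) (count-∪-∩ p q) ⟩
  count (p ∪ q) + count (p ∩ q) + count s               ≡⟨ swap₂₃ (count (p ∪ q)) (count (p ∩ q)) (count s) ⟩
  count (p ∪ q) + count s + count (p ∩ q)               ≡⟨ cong (_+ count (p ∩ q)) (count-∪-∩ (p ∪ q) s) ⟩
  count ((p ∪ q) ∪ s) + count ((p ∪ q) ∩ s) + count (p ∩ q)
    ≤⟨ +-monoˡ-≤ (count (p ∩ q)) (+-mono-≤ (count≤size ((p ∪ q) ∪ s)) (≤-trans (count-mono _ _ distrib) (count-∪ (p ∩ s) (q ∩ s)))) ⟩
  r + (count (p ∩ s) + count (q ∩ s)) + count (p ∩ q)   ≡⟨ regroup r (count (p ∩ q)) (count (p ∩ s)) (count (q ∩ s)) ⟩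
  r + (count (p ∩ q) + count (p ∩ s) + count (q ∩ s))   ∎
  where
  open ≤-Reasoning
  swap₂₃ : ∀ a b c → a + b + c ≡ a + c + b
  swap₂₃ = solve-∀
  regroup : ∀ a b c d → a + (c + d) + b ≡ a + (b + c + d)
  regroup = solve-∀
  distrib : ((p ∪ q) ∩ s) ⊆ ((p ∩ s) ∪ (q ∩ s))
  distrib i = trans (sym (∧-distribʳ-∨ (s i) (p i) (q i)))

isBlue : Colour → Bool
isBlue red  = false
isBlue blue = true

isBlue-true : ∀ {κ} → isBlue κ ≡ true → κ ≡ blue
isBlue-true {blue} _ = refl

isBlue-false : ∀ {κ} → not (isBlue κ) ≡ true → κ ≡ red
isBlue-false {red} _ = refl

blue⊎red : ∀ κ → κ ≡ blue ⊎ κ ≡ red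
blue⊎red blue = inj₁ refl
blue⊎red red  = inj₂ refl

adj⇒≢ : (F : Graph) {x y : Fin (size F)} → adj F x y ≡ true → x ≢ y
adj⇒≢ F {x} e refl = contradiction (trans (sym e) (irrefl F x)) λ ()

module _ (F : Graph) (c : Colouring F) where

  nbr : Colour → Fin (size F) → Fin (size F) → Bool
  nbr blue x w = adj F x w ∧ isBlue (col c x w)
  nbr red  x w = adj F x w ∧ not (isBlue (col c x w))

  commonBlueNbr : Fin (size F) → Fin (size F) → Fin (size F) → Bool
  commonBlueNbr a b = nbr blue a ∩ nbr blue b

  nbr-sym : ∀ κ x w → nbr κ x w ≡ nbr κ w x
  nbr-sym blue x w = cong₂ _∧_ (Graph.sym F x w) (cong isBlue (col-sym c x w))
  nbr-sym red  x w = cong₂ _∧_ (Graph.sym F x w) (cong (not ∘ isBlue) (col-sym c x w))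

  nbr⇒edge : ∀ κ {x w} → nbr κ x w ≡ true → adj F x w ≡ true × col c x w ≡ κ
  nbr⇒edge blue e = ∧-conicalˡ _ _ e , isBlue-true (∧-conicalʳ _ _ e)
  nbr⇒edge red  e = ∧-conicalˡ _ _ e , isBlue-false (∧-conicalʳ _ _ e)

  nbr⇒edge′ : ∀ κ {x w} → nbr κ x w ≡ true → adj F w x ≡ true × col c w x ≡ κ
  nbr⇒edge′ κ {x} {w} e = nbr⇒edge κ (trans (nbr-sym κ w x) e)

  edge⇒nbr : ∀ κ {x w} → adj F x w ≡ true → col c x w ≡ κ → nbr κ x w ≡ true
  edge⇒nbr blue a e = ∧-intro a (cong isBlue e)
  edge⇒nbr red  a e = ∧-intro a (cong (not ∘ isBlue) e)

  adj⇒blue⊎red : ∀ {x w} → adj F x w ≡ true → nbr blue x w ≡ true ⊎ nbr red x w ≡ true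
  adj⇒blue⊎red {x} {w} a = Sum.map (edge⇒nbr blue a) (edge⇒nbr red a) (blue⊎red (col c x w))

  nbr⇒≢ : ∀ κ {x w} → nbr κ x w ≡ true → x ≢ w
  nbr⇒≢ κ e = adj⇒≢ F (proj₁ (nbr⇒edge κ e))

  redStar : ∀ {n} x → n ≤ count (nbr red x) → MonoCopy F c red (Star n)
  redStar {n} x n≤deg with g , g-inj , g∈ ← ≤count⇒injection n (nbr red x) n≤deg =
    x Vector.∷ g , ∷-injective g-inj (λ i → nbr⇒≢ red (g∈ i) ∘ sym) , edge
    where
    edge : ∀ u v → starAdj u v ≡ true →
      adj F ((x Vector.∷ g) u) ((x Vector.∷ g) v) ≡ true × col c ((x Vector.∷ g) u) ((x Vector.∷ g) v) ≡ red
    edge zero    (suc j) _ = nbr⇒edge red (g∈ j)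
    edge (suc i) zero    _ = nbr⇒edge′ red (g∈ i)

  redStar⇒redDegree : ∀ {n} → MonoCopy F c red (Star n) → ∃ λ x → n ≤ count (nbr red x)
  redStar⇒redDegree {n} (f , f-inj , edge) =
    f zero , injection⇒≤count n _ (f ∘ suc) (Fin.suc-injective ∘ f-inj) λ i →
      let a , κ = edge zero (suc i) refl in edge⇒nbr red a κ

  blueBook : ∀ {m} a b → nbr blue a b ≡ true → m ≤ count (commonBlueNbr a b) → MonoCopy F c blue (Book m)
  blueBook {m} a b ab m≤codeg with g , g-inj , g∈ ← ≤count⇒injection m (commonBlueNbr a b) m≤codeg =
    f , ∷-injective (∷-injective g-inj (λ i → nbr⇒≢ blue (bg i) ∘ sym)) a≢ , edge
    where
    f = a Vector.∷ b Vector.∷ g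
    ag : ∀ i → nbr blue a (g i) ≡ true
    ag i = ∧-conicalˡ (nbr blue a (g i)) _ (g∈ i)
    bg : ∀ i → nbr blue b (g i) ≡ true
    bg i = ∧-conicalʳ (nbr blue a (g i)) _ (g∈ i)
    a≢ : ∀ i → (b Vector.∷ g) i ≢ a
    a≢ zero    = nbr⇒≢ blue ab ∘ sym
    a≢ (suc i) = nbr⇒≢ blue (ag i) ∘ sym
    edge : ∀ u v → bookAdj u v ≡ true → adj F (f u) (f v) ≡ true × col c (f u) (f v) ≡ blue
    edge zero             (suc zero)       _ = nbr⇒edge blue ab
    edge zero             (suc (suc j))    _ = nbr⇒edge blue (ag j)
    edge (suc zero)       zero             _ = nbr⇒edge′ blue ab
    edge (suc zero)       (suc (suc j))    _ = nbr⇒edge blue (bg j)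
    edge (suc (suc i))    zero             _ = nbr⇒edge′ blue (ag i)
    edge (suc (suc i))    (suc zero)       _ = nbr⇒edge′ blue (bg i)

  record Sparse (n m : ℕ) : Set where
    field
      redDegree<    : ∀ x → count (nbr red x) < n
      blueCodegree< : ∀ a b → nbr blue a b ≡ true → count (commonBlueNbr a b) < m

  monoCopy⊎sparse : ∀ n m → (MonoCopy F c red (Star n) ⊎ MonoCopy F c blue (Book m)) ⊎ Sparse n m
  monoCopy⊎sparse n m
    with any? (λ x → n ≤? count (nbr red x))
       | any? (λ a → any? (λ b → (nbr blue a b Bool.≟ true) ×-dec (m ≤? count (commonBlueNbr a b))))
  ... | yes (x , star) | _ = inj₁ (inj₁ (redStar x star))
  ... | no _ | yes (a , b , ab , book) = inj₁ (inj₂ (blueBook a b ab book))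
  ... | no ¬star | no ¬book = inj₂ record
    { redDegree<    = λ x → ≰⇒> (¬star ∘ (x ,_))
    ; blueCodegree< = λ a b ab → ≰⇒> (¬book ∘ (a ,_) ∘ (b ,_) ∘ (ab ,_))
    }

¬Sparse⇒Arrows : ∀ F {n m} → (∀ c → ¬ Sparse F c n m) → Arrows F (Star n) (Book m)
¬Sparse⇒Arrows F {n} {m} ¬sparse c = [ id , ⊥-elim ∘ ¬sparse c ]′ (monoCopy⊎sparse F c n m)

-- The graph K_r \ P_k

nonDegree : (F : Graph) → Fin (size F) → ℕ
nonDegree F x = count (∁ (adj F x))

module _ {r k : ℕ} where

  pathEdge-offPath : ∀ {x w : Fin r} → k ≤ toℕ x → pathEdge k x w ≡ false
  pathEdge-offPath h rewrite ≥⇒<ᵇ-false h = refl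

  pathEdge⇒adjacent : ∀ {x w : Fin r} → pathEdge k x w ≡ true →
    suc (toℕ x) ≡ toℕ w ⊎ suc (toℕ w) ≡ toℕ x
  pathEdge⇒adjacent {x} {w} e with suc (toℕ x) ≡ᵇ toℕ w in e′
  ... | true  = inj₁ (≡ᵇ-true⇒≡ e′)
  ... | false = inj₂ (≡ᵇ-true⇒≡ (∧-conicalʳ _ _ e))

  KminusP-adj-offPath : ∀ {x w : Fin r} → k ≤ toℕ x → x ≢ w → adj (KminusP r k) x w ≡ true
  KminusP-adj-offPath {w = w} h x≢w rewrite distinct-≢ x≢w | pathEdge-offPath {w = w} h = refl

  KminusP-¬adj : ∀ {x w : Fin r} → adj (KminusP r k) x w ≡ false → x ≡ w ⊎ pathEdge k x w ≡ true
  KminusP-¬adj {x} {w} h with x ≟ w | pathEdge k x w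
  ... | yes x≡w | _     = inj₁ x≡w
  ... | no _    | true  = inj₂ refl
  ... | no _    | false = contradiction h λ ()

  pathEdge-intro : ∀ {x w : Fin r} → toℕ x < k → toℕ w < k →
    suc (toℕ x) ≡ toℕ w ⊎ suc (toℕ w) ≡ toℕ x → pathEdge k x w ≡ true
  pathEdge-intro {x = x} {w} x<k w<k adjacent rewrite <⇒<ᵇ-true x<k | <⇒<ᵇ-true w<k =
    [ ∨-introˡ _ ∘ ≡⇒≡ᵇ-true , ∨-introʳ (suc (toℕ x) ≡ᵇ toℕ w) ∘ ≡⇒≡ᵇ-true ]′ adjacent

  pathEdge⇒¬adj : ∀ {x w : Fin r} → pathEdge k x w ≡ true → adj (KminusP r k) x w ≡ false
  pathEdge⇒¬adj {x = x} {w} e = trans (cong (λ p → distinct x w ∧ not p) e) (∧-zeroʳ (distinct x w))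

  nonDegree-offPath : ∀ {x : Fin r} → k ≤ toℕ x → nonDegree (KminusP r k) x ≤ 1
  nonDegree-offPath {x} h = count-≤1 _ λ _ ¬adj →
    [ cong toℕ ∘ sym , (λ e → contradiction (trans (sym e) (pathEdge-offPath h)) λ ()) ]′
      (KminusP-¬adj (not-injective {y = false} ¬adj))

  nonDegree≤3 : ∀ {x : Fin r} → nonDegree (KminusP r k) x ≤ 3
  nonDegree≤3 {x} = begin
    count (∁ (adj (KminusP r k) x))      ≤⟨ count-mono _ _ ¬adj⊆ ⟩
    count (at (toℕ x) ∪ (at (suc (toℕ x)) ∪ at (pred (toℕ x))))
      ≤⟨ count-∪ (at (toℕ x)) _ ⟩
    count (at (toℕ x)) + count (at (suc (toℕ x)) ∪ at (pred (toℕ x)))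
      ≤⟨ +-mono-≤ (at≤1 (toℕ x)) (≤-trans (count-∪ (at (suc (toℕ x))) _) (+-mono-≤ (at≤1 _) (at≤1 _))) ⟩
    3                                    ∎
    where
    open ≤-Reasoning
    at : ℕ → Fin r → Bool
    at j w = toℕ w ≡ᵇ j
    at≤1 : ∀ j → count (at j) ≤ 1
    at≤1 j = count-≤1 {k = j} (at j) λ _ → ≡ᵇ-true⇒≡
    ¬adj⊆ : ∁ (adj (KminusP r k) x) ⊆ (at (toℕ x) ∪ (at (suc (toℕ x)) ∪ at (pred (toℕ x))))
    ¬adj⊆ w ¬adj with KminusP-¬adj (not-injective {y = false} ¬adj)
    ... | inj₁ refl = ∨-introˡ (at (suc (toℕ x)) w ∨ at (pred (toℕ x)) w) (≡⇒≡ᵇ-true {toℕ w} refl)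
    ... | inj₂ e with pathEdge⇒adjacent e
    ...   | inj₁ x+1≡w = ∨-introʳ (at (toℕ x) w) (∨-introˡ (at (pred (toℕ x)) w) (≡⇒≡ᵇ-true (sym x+1≡w)))
    ...   | inj₂ w+1≡x = ∨-introʳ (at (toℕ x) w) (∨-introʳ (at (suc (toℕ x)) w) (≡⇒≡ᵇ-true (cong pred w+1≡x)))

KminusP⊆K : ∀ {r k} (i j : Fin r) → adj (KminusP r k) i j ≡ true → adj (K r) i j ≡ true
KminusP⊆K i j e = trans (∧-identityʳ (distinct i j)) (∧-conicalˡ _ _ e)

KminusP-Arrows⇒K-Arrows : ∀ {r} k {G H} → Arrows (KminusP r k) G H → Arrows (K r) G H
KminusP-Arrows⇒K-Arrows {r} k {G} {H} arrows c = Sum.map (transfer {red} {G}) (transfer {blue} {H}) (arrows c′)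
  where
  c′ : Colouring (KminusP r k)
  c′ = record { col = col c ; col-sym = col-sym c }
  transfer : ∀ {κ L} → MonoCopy (KminusP r k) c′ κ L → MonoCopy (K r) c κ L
  transfer (f , f-inj , edge) = f , f-inj , λ u v e → let a , κ = edge u v e in KminusP⊆K {k = k} (f u) (f v) a , κ

-- The upper bound

blueDegree-bound : ∀ {n b d z t} → b + d + z ≡ suc (n + n) → d < n → z ≤ suc t → suc n ≤ t + b
blueDegree-bound {n} {b} {d} {z} {t} total d<n z≤ = +-cancelʳ-≤ (n + suc d) (suc n) (t + b) (begin
  suc n + (n + suc d)    ≡⟨ shift n d ⟩
  suc (n + n) + suc d    ≡⟨ cong (_+ suc d) (sym total) ⟩
  b + d + z + suc d      ≤⟨ +-mono-≤ (+-monoʳ-≤ (b + d) z≤) d<n ⟩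
  b + d + suc t + n      ≡⟨ regroup b d t n ⟩
  t + b + (n + suc d)    ∎)
  where
  open ≤-Reasoning
  shift : ∀ n d → suc n + (n + suc d) ≡ suc (n + n) + suc d
  shift = solve-∀
  regroup : ∀ b d t n → b + d + suc t + n ≡ t + b + (n + suc d)
  regroup = solve-∀

0<-of-excess : ∀ {n a b} → suc n ≤ a + b → a ≤ n → 0 < b
0<-of-excess {n} {a} {zero}  h a≤n = contradiction (≤-trans h (subst (_≤ n) (sym (+-identityʳ a)) a≤n)) (1+n≰n)
0<-of-excess {b = suc b} _ _ = z<s

degree-codegree-clash : ∀ {n m du dv dv′ x y z} → suc n ≤ du → suc n ≤ dv → suc n ≤ 2 + dv′ →
  du + dv + dv′ ≤ suc (n + n) + (x + y + z) → x < m → y < m → z < m → 3 * m ≤ n + 2 → ⊥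
degree-codegree-clash {n} {m} {du} {dv} {dv′} {x} {y} {z} hu hv hv′ sum hx hy hz 3m≤ =
  1+n≰n (+-cancelˡ-≤ (x + y + z) _ _ (begin
    x + y + z + suc (n + n + n + 5)                   ≡⟨ e₁ n x y z ⟩
    (suc n + suc n + suc n) + (suc x + suc y + suc z) ≤⟨ +-mono-≤ (+-mono-≤ (+-mono-≤ hu hv) hv′) (+-mono-≤ (+-mono-≤ hx hy) hz) ⟩
    (du + dv + (2 + dv′)) + (m + m + m)               ≡⟨ e₂ du dv dv′ m ⟩
    2 + (du + dv + dv′) + 3 * m                       ≤⟨ +-mono-≤ (+-monoʳ-≤ 2 sum) 3m≤ ⟩
    2 + (suc (n + n) + (x + y + z)) + (n + 2)         ≡⟨ e₃ n (x + y + z) ⟩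
    x + y + z + (n + n + n + 5)                       ∎))
  where
  open ≤-Reasoning
  e₁ : ∀ n x y z → x + y + z + suc (n + n + n + 5) ≡ (suc n + suc n + suc n) + (suc x + suc y + suc z)
  e₁ = solve-∀
  e₂ : ∀ a b c m → a + b + (2 + c) + (m + m + m) ≡ 2 + (a + b + c) + 3 * m
  e₂ = solve-∀
  e₃ : ∀ n s → 2 + (suc (n + n) + s) + (n + 2) ≡ s + (n + n + n + 5)
  e₃ = solve-∀

module _ {n m : ℕ} (c : Colouring (KminusP (suc (n + n)) n))
         (sparse : Sparse (KminusP (suc (n + n)) n) c n m) where
  open Sparse sparse

  private
    F = KminusP (suc (n + n)) n
    V = Fin (suc (n + n))
    blueNbr redNbr : V → V → Bool
    blueNbr = nbr F c blue
    redNbr  = nbr F c red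

  blueDegree≥ : ∀ x t → nonDegree F x ≤ suc t → suc n ≤ t + count (blueNbr x)
  blueDegree≥ x t = blueDegree-bound
    (trans (cong (_+ nonDegree F x) (sym (count-∩-∩∁ (adj F x) (isBlue ∘ col c x)))) (count+count-∁ (adj F x)))
    (redDegree< x)

  onPath : V → Bool
  onPath w = toℕ w <ᵇ n

  count-onPath : count onPath ≤ n
  count-onPath = subst (_≤ n) (sym (count-toℕ<ᵇ (suc (n + n)) n)) (m⊓n≤n _ n)

  offPathBlueNbr : ∀ x → suc n ≤ count (blueNbr x) → ∃ λ v → blueNbr x v ≡ true × n ≤ toℕ v
  offPathBlueNbr x n<deg
    with v , v∈ ← 0<count⇒∃ (blueNbr x ∩ ∁ onPath) (0<-of-excess
                    (subst (suc n ≤_) (count-∩-∩∁ (blueNbr x) onPath) n<deg)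
                    (≤-trans (count-mono _ onPath (λ i → ∧-conicalʳ (blueNbr x i) _)) count-onPath))
    = v , ∧-conicalˡ _ _ v∈ , <ᵇ-false⇒≥ (not-injective {y = false} (∧-conicalʳ _ _ v∈))

  commonBlueNbr-offPath : ∀ {u v} → blueNbr u v ≡ true → n ≤ toℕ v → suc n ≤ count (blueNbr u) →
    ∃ λ w → commonBlueNbr F c u v w ≡ true
  commonBlueNbr-offPath {u} {v} uv v-off n<deg = 0<count⇒∃ (commonBlueNbr F c u v) (0<-of-excess
    (begin
      suc n                                                 ≤⟨ n<deg ⟩
      count (blueNbr u)                                     ≤⟨ count-mono _ _ blue⊆ ⟩
      count (commonBlueNbr F c u v ∪ (redNbr v ∪ isV))      ≤⟨ count-∪ (commonBlueNbr F c u v) (redNbr v ∪ isV) ⟩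
      count (commonBlueNbr F c u v) + count (redNbr v ∪ isV) ≡⟨ +-comm (count (commonBlueNbr F c u v)) _ ⟩
      count (redNbr v ∪ isV) + count (commonBlueNbr F c u v) ∎)
    (begin
      count (redNbr v ∪ isV)       ≤⟨ count-∪ (redNbr v) isV ⟩
      count (redNbr v) + count isV ≤⟨ +-monoʳ-≤ (count (redNbr v)) (count-≤1 {k = toℕ v} isV λ _ → ≡ᵇ-true⇒≡) ⟩
      count (redNbr v) + 1         ≡⟨ +-comm _ 1 ⟩
      suc (count (redNbr v))       ≤⟨ redDegree< v ⟩
      n                            ∎))
    where
    open ≤-Reasoning
    isV : V → Bool
    isV w = toℕ w ≡ᵇ toℕ v
    blue⊆ : blueNbr u ⊆ (commonBlueNbr F c u v ∪ (redNbr v ∪ isV))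
    blue⊆ w uw with w ≟ v
    ... | yes refl = ∨-introʳ (commonBlueNbr F c u v w) (∨-introʳ (redNbr v w) (≡⇒≡ᵇ-true {toℕ w} refl))
    ... | no w≢v = [ (λ vw → ∨-introˡ (redNbr v w ∨ isV w) (∧-intro uw vw))
                   , (λ vw → ∨-introʳ (commonBlueNbr F c u v w) (∨-introˡ (isV w) vw)) ]′
                   (adj⇒blue⊎red F c (KminusP-adj-offPath v-off (w≢v ∘ sym)))

  private
    u : V
    u = fromℕ (n + n)
    u-offPath : n ≤ toℕ u
    u-offPath = subst (n ≤_) (sym (toℕ-fromℕ (n + n))) (m≤m+n n n)

  blueDegree-offPath : ∀ x → n ≤ toℕ x → suc n ≤ count (blueNbr x)
  blueDegree-offPath x = blueDegree≥ x 0 ∘ nonDegree-offPath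

  KminusP-¬Sparse : 3 * m ≤ n + 2 → ⊥
  KminusP-¬Sparse 3m≤ =
    let v  , uv , v-off = offPathBlueNbr u (blueDegree-offPath u u-offPath)
        v′ , uvv′       = commonBlueNbr-offPath uv v-off (blueDegree-offPath u u-offPath)
    in degree-codegree-clash
         (blueDegree-offPath u u-offPath) (blueDegree-offPath v v-off) (blueDegree≥ v′ 2 (nonDegree≤3 {k = n} {x = v′}))
         (count-bonferroni (blueNbr u) (blueNbr v) (blueNbr v′))
         (blueCodegree< u v uv) (blueCodegree< u v′ (∧-conicalˡ (blueNbr u v′) _ uvv′))
         (blueCodegree< v v′ (∧-conicalʳ (blueNbr u v′) _ uvv′))
         3m≤

KminusP-Arrows : ∀ {n m} → 3 * m ≤ n + 2 → Arrows (KminusP (suc (n + n)) n) (Star n) (Book m)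
KminusP-Arrows 3m≤ = ¬Sparse⇒Arrows _ λ c sparse → KminusP-¬Sparse c sparse 3m≤

-- The lower bounds

sameSide : (Fin r → Bool) → Fin r → Fin r → Bool
sameSide s x w = if s x then s w else not (s w)

sameSide-refl : (s : Fin r → Bool) (x : Fin r) → sameSide s x x ≡ true
sameSide-refl s x with s x
... | true  = refl
... | false = refl

sameSide-sym : (s : Fin r → Bool) (x w : Fin r) → sameSide s x w ≡ sameSide s w x
sameSide-sym s x w with s x | s w
... | true  | true  = refl
... | true  | false = refl
... | false | true  = refl
... | false | false = refl

sameSide-triangle : (s : Fin r → Bool) (a b d : Fin r) →
  sameSide s a b ≡ false → sameSide s a d ≡ false → sameSide s b d ≡ false → ⊥
sameSide-triangle s a b d with s a | s b | s d
... | true  | true  | _     = λ ()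
... | false | false | _     = λ ()
... | true  | false | true  = λ _ ()
... | false | true  | false = λ _ ()
... | true  | false | false = λ _ _ ()
... | false | true  | true  = λ _ _ ()

count-sameSide : (s : Fin r → Bool) (x : Fin r) {b : Bool} → s x ≡ b →
  count (sameSide s x) ≡ (if b then count s else count (∁ s))
count-sameSide s x refl with s x
... | true  = refl
... | false = refl

red-if : ∀ b → (if b then red else blue) ≡ red → b ≡ true
red-if true _ = refl

blue-if : ∀ b → (if b then red else blue) ≡ blue → b ≡ false
blue-if false _ = refl

sideColouring : (F : Graph) → (Fin (size F) → Bool) → Colouring F
sideColouring F s = record
  { col     = λ i j → if sameSide s i j then red else blue
  ; col-sym = λ i j → cong (λ b → if b then red else blue) (sameSide-sym s i j)
  }

module _ (F : Graph) (s : Fin (size F) → Bool) where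
  private
    c = sideColouring F s

  sideColouring-red⊆ : ∀ x → nbr F c red x ⊆ (sameSide s x - x)
  sideColouring-red⊆ x w e = ∧-intro (distinct-≢ (adj⇒≢ F a ∘ sym)) (red-if _ κ)
    where
    a = proj₁ (nbr⇒edge F c red e)
    κ = proj₂ (nbr⇒edge F c red e)

  sideColouring-redDegree< : ∀ x → count (nbr F c red x) < count (sameSide s x)
  sideColouring-redDegree< x = begin-strict
    count (nbr F c red x)          ≤⟨ count-mono _ _ (sideColouring-red⊆ x) ⟩
    count (sameSide s x - x)       <⟨ n<1+n _ ⟩
    suc (count (sameSide s x - x)) ≡⟨ sym (count-remove _ x (sameSide-refl s x)) ⟩
    count (sameSide s x)           ∎
    where open ≤-Reasoning

  sideColouring-noBlueBook : ∀ {m} → ¬ MonoCopy F c blue (Book (suc m))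
  sideColouring-noBlueBook (f , _ , edge) = sameSide-triangle s (f zero) (f (suc zero)) (f (suc (suc zero)))
    (blue-if _ (proj₂ (edge zero (suc zero) refl)))
    (blue-if _ (proj₂ (edge zero (suc (suc zero)) refl)))
    (blue-if _ (proj₂ (edge (suc zero) (suc (suc zero)) refl)))

  sideColouring-¬Arrows : ∀ {n m} → (∀ x → count (nbr F c red x) < n) → ¬ Arrows F (Star n) (Book (suc m))
  sideColouring-¬Arrows redDegree< arrows with arrows c
  ... | inj₁ star = let x , n≤deg = redStar⇒redDegree F c star in <⇒≱ (redDegree< x) n≤deg
  ... | inj₂ book = sideColouring-noBlueBook book

complement-≤ : ∀ {s n a b} → a + b ≡ s → a ≡ s ⊓ n → s ≤ n + n → b ≤ n
complement-≤ {s} {n} {a} {b} a+b≡s a≡ s≤2n with ≤-total s n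
... | inj₁ s≤n = subst (_≤ n) (sym b≡0) z≤n
  where
  b≡0 : b ≡ 0
  b≡0 = +-cancelˡ-≡ a b 0 (trans a+b≡s (trans (sym (m≤n⇒m⊓n≡m s≤n)) (trans (sym a≡) (sym (+-identityʳ a)))))
... | inj₂ n≤s = +-cancelˡ-≤ n b n (subst (λ a → a + b ≤ n + n) (trans a≡ (m≥n⇒m⊓n≡n n≤s)) (subst (_≤ n + n) (sym a+b≡s) s≤2n))

K-¬Arrows : ∀ {n m s} → s ≤ n + n → ¬ Arrows (K s) (Star n) (Book (suc m))
K-¬Arrows {n} {m} {s} s≤2n = sideColouring-¬Arrows (K s) side λ x →
  <-≤-trans (sideColouring-redDegree< (K s) side x) (bySide x (side x) refl)
  where
  side : Fin s → Bool
  side w = toℕ w <ᵇ n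
  count-side : count side ≡ s ⊓ n
  count-side = count-toℕ<ᵇ s n
  bySide : ∀ x b → side x ≡ b → count (sameSide side x) ≤ n
  bySide x true  sx = subst (_≤ n) (sym (trans (count-sameSide side x sx) count-side)) (m⊓n≤n s n)
  bySide x false sx = subst (_≤ n) (sym (count-sameSide side x sx)) (complement-≤ (count+count-∁ side) count-side s≤2n)

pathNbr : ∀ {n} → 0 < n → (x : Fin (suc (n + n))) → toℕ x ≤ n →
  ∃ λ (y : Fin (suc (n + n))) → toℕ y ≤ n × (suc (toℕ x) ≡ toℕ y ⊎ suc (toℕ y) ≡ toℕ x)
pathNbr {n} 0<n zero    _   = fromℕ< 1<size , subst (_≤ n) (sym (toℕ-fromℕ< 1<size)) 0<n , inj₁ (sym (toℕ-fromℕ< 1<size))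
  where
  1<size : 1 < suc (n + n)
  1<size = s≤s (≤-trans 0<n (m≤m+n n n))
pathNbr {n} 0<n (suc x) x<n = inject₁ x , subst (_≤ n) (sym (toℕ-inject₁ x)) (<⇒≤ x<n) , inj₂ (cong suc (toℕ-inject₁ x))

KminusP-¬Arrows : ∀ {n m j} → 0 < n → n < j → j ≤ suc (n + n) →
  ¬ Arrows (KminusP (suc (n + n)) j) (Star n) (Book (suc m))
KminusP-¬Arrows {n} {m} {j} 0<n n<j j≤size = sideColouring-¬Arrows F side λ x → bySide x (side x) refl
  where
  F = KminusP (suc (n + n)) j
  side : Fin (suc (n + n)) → Bool
  side w = toℕ w <ᵇ suc n
  c = sideColouring F side
  count-side : count side ≡ suc n
  count-side = trans (count-toℕ<ᵇ _ (suc n)) (m≥n⇒m⊓n≡n (s≤s (m≤m+n n n)))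
  count-∁side : count (∁ side) ≡ n
  count-∁side = +-cancelˡ-≡ (suc n) _ _ (trans (cong (_+ count (∁ side)) (sym count-side)) (count+count-∁ side))
  bySide : ∀ x b → side x ≡ b → count (nbr F c red x) < n
  bySide x false sx = subst (count (nbr F c red x) <_) (trans (count-sameSide side x sx) count-∁side)
    (sideColouring-redDegree< F side x)
  bySide x true  sx with y , y≤n , adjacent ← pathNbr 0<n x (s≤s⁻¹ (<ᵇ-true⇒< sx)) = begin-strict
    count (nbr F c red x)      <⟨ count-< _ _ y (sideColouring-red⊆ F side x) y∈ y∉ ⟩
    count (sameSide side x - x) ≡⟨ suc-injective (trans (sym (count-remove (sameSide side x) x (sameSide-refl side x))) (trans (count-sameSide side x sx) count-side)) ⟩
    n                           ∎
    where
    open ≤-Reasoning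
    xy : pathEdge j x y ≡ true
    xy = pathEdge-intro (<-≤-trans (s≤s⁻¹ (<ᵇ-true⇒< sx)) n<j) (<-≤-trans (s≤s y≤n) n<j) adjacent
    y≢x : y ≢ x
    y≢x refl = [ 1+n≢n , 1+n≢n ]′ adjacent
    y∉ : nbr F c red x y ≡ false
    y∉ = cong (_∧ not (isBlue (col c x y))) (pathEdge⇒¬adj {k = j} xy)
    y∈ : (sameSide side x - x) y ≡ true
    y∈ = ∧-intro (distinct-≢ y≢x) (trans (cong (λ b → if b then side y else not (side y)) sx) (<⇒<ᵇ-true (s≤s y≤n)))

theorem2 : (m n : ℕ) → 2 ≤ m → 3 * m + 2 ≤ n →
    IsPathCriticalRamseyNumber (Star n) (Book m) n
theorem2 zero    n () _
theorem2 (suc m) n _  3m+2≤n =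
  suc (n + n) , (K-arrows , λ s s<r → K-¬Arrows (s≤s⁻¹ s<r)) ,
  m≤n⇒m≤1+n (m≤m+n n n) , arrows , λ j → KminusP-¬Arrows 0<n
  where
  arrows : Arrows (KminusP (suc (n + n)) n) (Star n) (Book (suc m))
  arrows = KminusP-Arrows (≤-trans (m≤m+n (3 * suc m) 2) (≤-trans 3m+2≤n (m≤m+n n 2)))
  K-arrows : Arrows (K (suc (n + n))) (Star n) (Book (suc m))
  K-arrows = KminusP-Arrows⇒K-Arrows n {Star n} {Book (suc m)} arrows
  0<n : 0 < n
  0<n = ≤-trans (s≤s z≤n) (≤-trans (m≤n+m 2 (3 * suc m)) 3m+2≤n)
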